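{- For any two integers $2\le a<b$ there is a finite simple connected graph $G$ with $\mathrm{gp}^-(G)=a$, $\mathrm{gp}(G)=b$, and $n(G)=b+\max\{1,a-\lfloor b/2\rfloor\}$.
   Context: A set $S$ of vertices of a connected graph $G$ is a general position set if no shortest path contains three or more vertices of $S$. $\mathrm{gp}(G)$ is the size of a largest general position set; a general position set is maximal if not properly contained in another one, and $\mathrm{gp}^-(G)$ is the size of a smallest maximal general position set. $n(G)$ denotes the number of vertices of $G$. -}

module Defs where

open import Data.Nat using (ℕ; zero; suc; _≤_)
open import Data.Fin using (Fin)
open import Data.Fin.Subset using (Subset; _∈_; _⊆_; ∣_∣)
open import Data.List using (List; []; _∷_)
import Data.List.Membership.Propositional as LM
open import Data.Product using (Σ; _×_; ∃)
open import Relation.Binary.PropositionalEquality using (_≡_)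
open import Relation.Nullary using (¬_)
open import Data.Empty using (⊥)

record Graph (n : ℕ) : Set₁ where
  field
    Adj     : Fin n → Fin n → Set
    sym     : ∀ {u v} → Adj u v → Adj v u
    irrefl  : ∀ {u} → ¬ Adj u u

module _ {n : ℕ} (G : Graph n) where
  open Graph G

  data Walk : Fin n → Fin n → Set where
    []  : ∀ {u} → Walk u u
    _∷_ : ∀ {u v w} → Adj u v → Walk v w → Walk u w

  walkLength : ∀ {u v} → Walk u v → ℕ
  walkLength []      = zero
  walkLength (_ ∷ p) = suc (walkLength p)

  vertices : ∀ {u v} → Walk u v → List (Fin n)
  vertices {u} []      = u ∷ []
  vertices {u} (_ ∷ p) = u ∷ vertices p

  IsShortest : ∀ {u v} → Walk u v → Set
  IsShortest {u} {v} p = (q : Walk u v) → walkLength p ≤ walkLength q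

  Connected : Set
  Connected = (u v : Fin n) → Walk u v

  IsGeneralPosition : Subset n → Set
  IsGeneralPosition S =
    ∀ {u v} (p : Walk u v) → IsShortest p →
    (x y z : Fin n) → x ∈ S → y ∈ S → z ∈ S →
    ¬ x ≡ y → ¬ y ≡ z → ¬ x ≡ z →
    LM._∈_ x (vertices p) → LM._∈_ y (vertices p) → LM._∈_ z (vertices p) →
    ⊥

  IsMaximalGP : Subset n → Set
  IsMaximalGP S =
    IsGeneralPosition S × ((T : Subset n) → IsGeneralPosition T → S ⊆ T → T ⊆ S)

  GpNumber : ℕ → Set
  GpNumber k =
    (Σ (Subset n) λ S → IsGeneralPosition S × ∣ S ∣ ≡ k) ×
    ((S : Subset n) → IsGeneralPosition S → ∣ S ∣ ≤ k)

  GpMinusNumber : ℕ → Set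
  GpMinusNumber k =
    (Σ (Subset n) λ S → IsMaximalGP S × ∣ S ∣ ≡ k) ×
    ((S : Subset n) → IsMaximalGP S → k ≤ ∣ S ∣)

-- Split the vertices into parts X, M, Y of sizes p ≤ q ≤ r and join two distinct
-- vertices unless one lies in X and the other in Y, i.e. glue the cliques X ∪ M and
-- M ∪ Y along M. Its diameter is 2 and the geodesics of length two are the
-- paths x – m – y, so a set is in general position iff it misses one of the parts.
-- Hence the maximal general position sets are exactly the unions of two parts: the
-- largest has q + r vertices and the smallest p + q. With p = max(1, a − ⌊b/2⌋),
-- q = a − p and r = b − q this gives gp⁻ = a, gp = b and n = b + p.
module Submission where

open import Defs
open import Data.Nat using (ℕ; _+_; _∸_; _⊔_; _≤_; _<_; _/_)
open import Data.Product using (Σ; _×_)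

open import Data.Nat using (suc; z≤n; s≤s; _⊓_; _*_; _%_)
open import Data.Nat.Properties
  using (≤-refl; ≤-trans; ≤-pred; <⇒≤; +-comm; +-identityʳ; *-comm; +-mono-≤; +-monoˡ-≤; +-monoʳ-≤;
         m≤m+n; m≤n+m; m<n⇒0<n∸m; m≤n+o⇒m∸n≤o; m+n≤o⇒m≤o∸n; m∸n+n≡m; m+[n∸m]≡n; m+n∸n≡m;
         ∸-distribˡ-⊓-⊔; m⊓n≤m; m⊓n≤n; ⊓-sel)
open import Data.Nat.DivMod using (m≡m%n+[m/n]*n; m%n<n)
open import Data.Fin using (Fin; _↑ˡ_; _↑ʳ_; fromℕ<)
open import Data.Fin.Properties using (any?) renaming (_≟_ to _≟ᶠ_)
open import Data.Fin.Subset using (Subset; Side; inside; outside; ∣_∣) renaming (_∈_ to _∈ₛ_; _⊆_ to _⊆ₛ_)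
open import Data.Fin.Subset.Properties using (p⊆q⇒∣p∣≤∣q∣; _∈?_; ∣⊤∣≡n; ∣⊥∣≡0)
open import Data.Vec using (Vec; []; _∷_; _++_; replicate; lookup; map)
open import Data.Vec.Properties using (lookup-map; map-++; map-replicate; lookup-++ˡ; lookup-++ʳ; lookup-replicate; []=⇒lookup; lookup⇒[]=)
open import Data.List using ([]; _∷_)
open import Data.List.Membership.Propositional using (_∈_)
open import Data.List.Relation.Unary.Any using (here; there)
open import Data.Product using (_,_; proj₁; proj₂; ∃)
open import Data.Sum using (_⊎_; inj₁; inj₂)
open import Data.Empty using (⊥; ⊥-elim)
open import Function using (_∘_; id; case_of_)
open import Relation.Nullary using (¬_; Dec; yes; no; contradiction)
open import Relation.Nullary.Decidable using (isNo; _×-dec_)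
open import Relation.Binary.Definitions using (DecidableEquality)
open import Relation.Binary.PropositionalEquality

private
  variable
    A : Set
    a b u m v x y z : A

∈-pair : x ∈ a ∷ b ∷ [] → x ≡ a ⊎ x ≡ b
∈-pair (here x≡a)         = inj₁ x≡a
∈-pair (there (here x≡b)) = inj₂ x≡b

no-three-distinct-in-pair : x ≢ y → y ≢ z → x ≢ z →
  x ∈ a ∷ b ∷ [] → y ∈ a ∷ b ∷ [] → z ∈ a ∷ b ∷ [] → ⊥
no-three-distinct-in-pair x≢y y≢z x≢z x∈ y∈ z∈ with ∈-pair x∈ | ∈-pair y∈ | ∈-pair z∈
... | inj₁ refl | inj₁ refl | _         = x≢y refl
... | inj₂ refl | inj₂ refl | _         = x≢y refl
... | inj₁ refl | inj₂ refl | inj₁ refl = x≢z refl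
... | inj₁ refl | inj₂ refl | inj₂ refl = y≢z refl
... | inj₂ refl | inj₁ refl | inj₁ refl = y≢z refl
... | inj₂ refl | inj₁ refl | inj₂ refl = x≢z refl

∈-triple : x ∈ u ∷ m ∷ v ∷ [] → x ≡ u ⊎ x ≡ m ⊎ x ≡ v
∈-triple (here x≡u)                 = inj₁ x≡u
∈-triple (there (here x≡m))         = inj₂ (inj₁ x≡m)
∈-triple (there (there (here x≡v))) = inj₂ (inj₂ x≡v)

distinct-triple-covers : (P : A → Set) → P x → P y → P z → x ≢ y → y ≢ z → x ≢ z →
  x ∈ u ∷ m ∷ v ∷ [] → y ∈ u ∷ m ∷ v ∷ [] → z ∈ u ∷ m ∷ v ∷ [] → P u × P m × P v
distinct-triple-covers P px py pz x≢y y≢z x≢z x∈ y∈ z∈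
  with ∈-triple x∈ | ∈-triple y∈ | ∈-triple z∈
... | inj₁ refl        | inj₁ refl        | _                = contradiction refl x≢y
... | inj₂ (inj₁ refl) | inj₂ (inj₁ refl) | _                = contradiction refl x≢y
... | inj₂ (inj₂ refl) | inj₂ (inj₂ refl) | _                = contradiction refl x≢y
... | _                | inj₁ refl        | inj₁ refl        = contradiction refl y≢z
... | _                | inj₂ (inj₁ refl) | inj₂ (inj₁ refl) = contradiction refl y≢z
... | _                | inj₂ (inj₂ refl) | inj₂ (inj₂ refl) = contradiction refl y≢z
... | inj₁ refl        | _                | inj₁ refl        = contradiction refl x≢z
... | inj₂ (inj₁ refl) | _                | inj₂ (inj₁ refl) = contradiction refl x≢z
... | inj₂ (inj₂ refl) | _                | inj₂ (inj₂ refl) = contradiction refl x≢z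
... | inj₁ refl        | inj₂ (inj₁ refl) | inj₂ (inj₂ refl) = px , py , pz
... | inj₁ refl        | inj₂ (inj₂ refl) | inj₂ (inj₁ refl) = px , pz , py
... | inj₂ (inj₁ refl) | inj₁ refl        | inj₂ (inj₂ refl) = py , px , pz
... | inj₂ (inj₁ refl) | inj₂ (inj₂ refl) | inj₁ refl        = pz , px , py
... | inj₂ (inj₂ refl) | inj₁ refl        | inj₂ (inj₁ refl) = py , pz , px
... | inj₂ (inj₂ refl) | inj₂ (inj₁ refl) | inj₁ refl        = pz , py , px

module _ {n : ℕ} (G : Graph n) where
  open Graph G

  DiameterAtMost2 : Set
  DiameterAtMost2 = (u v : Fin n) → Σ (Walk G u v) λ w → walkLength G w ≤ 2

  Between : Fin n → Fin n → Fin n → Set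
  Between u m v = Σ (Adj u m) λ e → Σ (Adj m v) λ e′ → IsShortest G (e ∷ e′ ∷ [])

  geodesic-length≤2 : DiameterAtMost2 → ∀ {u v} {w : Walk G u v} → IsShortest G w → walkLength G w ≤ 2
  geodesic-length≤2 diam {u} {v} w-short = ≤-trans (w-short (proj₁ (diam u v))) (proj₂ (diam u v))

  between-distinct : ∀ {u m v} → Between u m v → u ≢ m × m ≢ v × u ≢ v
  between-distinct {u} {m} {v} (e , e′ , short) = (λ { refl → irrefl e }) , (λ { refl → irrefl e′ }) , u≢v
    where
    u≢v : u ≢ v
    u≢v refl with short []
    ... | ()

  between-nonadjacent : ∀ {u m v} → Between u m v → ¬ Adj u v
  between-nonadjacent (_ , _ , short) e with short (e ∷ [])
  ... | s≤s ()

  gp⇒¬between : ∀ {S} → IsGeneralPosition G S → ∀ {u m v} → Between u m v →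
    u ∈ₛ S → m ∈ₛ S → v ∈ₛ S → ⊥
  gp⇒¬between gp {u} {m} {v} btw@(e , e′ , short) u∈S m∈S v∈S =
    let u≢m , m≢v , u≢v = between-distinct btw in
    gp (e ∷ e′ ∷ []) short u m v u∈S m∈S v∈S u≢m m≢v u≢v
       (here refl) (there (here refl)) (there (there (here refl)))
  ¬between⇒gp : DiameterAtMost2 → ∀ {S} →
    (∀ {u m v} → Between u m v → u ∈ₛ S → m ∈ₛ S → v ∈ₛ S → ⊥) → IsGeneralPosition G S
  ¬between⇒gp diam {S} ¬between w short x y z x∈S y∈S z∈S x≢y y≢z x≢z =
    on-geodesic w short (geodesic-length≤2 diam short)
    where
    on-geodesic : ∀ {u v} (w : Walk G u v) → IsShortest G w → walkLength G w ≤ 2 →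
      x ∈ vertices G w → y ∈ vertices G w → z ∈ vertices G w → ⊥
    on-geodesic [] _ _ (here refl) (here refl) _ = x≢y refl
    on-geodesic (e ∷ []) _ _ x∈ y∈ z∈ = no-three-distinct-in-pair x≢y y≢z x≢z x∈ y∈ z∈
    on-geodesic (e ∷ e′ ∷ []) short _ x∈ y∈ z∈
      with distinct-triple-covers (_∈ₛ S) x∈S y∈S z∈S x≢y y≢z x≢z x∈ y∈ z∈
    ... | u∈S , m∈S , v∈S = ¬between (e , e′ , short) u∈S m∈S v∈S
    on-geodesic (_ ∷ _ ∷ _ ∷ _) _ (s≤s (s≤s ()))

data Part : Set where
  X M Y : Part

_≟_ : DecidableEquality Part
X ≟ X = yes refl
M ≟ M = yes refl
Y ≟ Y = yes refl
X ≟ M = no λ ()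
X ≟ Y = no λ ()
M ≟ X = no λ ()
M ≟ Y = no λ ()
Y ≟ X = no λ ()
Y ≟ M = no λ ()

data Opposite : Part → Part → Set where
  X-Y : Opposite X Y
  Y-X : Opposite Y X

opposite? : (c d : Part) → Dec (Opposite c d)
opposite? X Y = yes X-Y
opposite? Y X = yes Y-X
opposite? X X = no λ ()
opposite? X M = no λ ()
opposite? M _ = no λ ()
opposite? Y M = no λ ()
opposite? Y Y = no λ ()

opposite-sym : ∀ {c d} → Opposite c d → Opposite d c
opposite-sym X-Y = Y-X
opposite-sym Y-X = X-Y

opposite-≢M : ∀ {c d} → Opposite c d → c ≢ M × d ≢ M
opposite-≢M X-Y = (λ ()) , (λ ())
opposite-≢M Y-X = (λ ()) , (λ ())

¬opposite-M : ∀ {c} → ¬ Opposite c M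
¬opposite-M ()

opposite-irrefl : ∀ {c} → ¬ Opposite c c
opposite-irrefl ()

between-opposites : ∀ {c d} e → Opposite c d → ¬ Opposite c e → ¬ Opposite e d → e ≡ M
between-opposites X X-Y _ ¬XY = contradiction X-Y ¬XY
between-opposites M X-Y _ _   = refl
between-opposites Y X-Y ¬XY _ = contradiction X-Y ¬XY
between-opposites X Y-X ¬YX _ = contradiction Y-X ¬YX
between-opposites M Y-X _ _   = refl
between-opposites Y Y-X _ ¬YX = contradiction Y-X ¬YX

opposites-cover : ∀ {d e} c → Opposite d e → c ≡ d ⊎ c ≡ M ⊎ c ≡ e
opposites-cover X X-Y = inj₁ refl
opposites-cover M X-Y = inj₂ (inj₁ refl)
opposites-cover Y X-Y = inj₂ (inj₂ refl)
opposites-cover X Y-X = inj₂ (inj₂ refl)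
opposites-cover M Y-X = inj₂ (inj₁ refl)
opposites-cover Y Y-X = inj₁ refl

module GluedCliques {n : ℕ} (parts : Vec Part n) where

  part : Fin n → Part
  part = lookup parts

  Adjacent : Fin n → Fin n → Set
  Adjacent u v = u ≢ v × ¬ Opposite (part u) (part v)

  G : Graph n
  G = record
    { Adj    = Adjacent
    ; sym    = λ (u≢v , ¬opp) → (u≢v ∘ sym) , (¬opp ∘ opposite-sym)
    ; irrefl = λ (u≢u , _) → u≢u refl
    }

  ≢-by-part : ∀ {u v} → part u ≢ part v → u ≢ v
  ≢-by-part neq refl = neq refl

  adjacent-M : ∀ {u m} → part u ≢ M → part m ≡ M → Adjacent u m
  adjacent-M u∉M m∈M = ≢-by-part (λ u~m → u∉M (trans u~m m∈M)) , (¬opposite-M ∘ subst (Opposite _) m∈M)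

  opposite-distance : ∀ {u v} → Opposite (part u) (part v) → (w : Walk G u v) → 2 ≤ walkLength G w
  opposite-distance opp []                = contradiction opp opposite-irrefl
  opposite-distance opp ((_ , ¬opp) ∷ []) = contradiction opp ¬opp
  opposite-distance opp (_ ∷ _ ∷ _)       = s≤s (s≤s z≤n)

  opposite-between : ∀ {u m v} → Opposite (part u) (part v) → part m ≡ M → Between G u m v
  opposite-between opp m∈M =
      adjacent-M (proj₁ (opposite-≢M opp)) m∈M
    , Graph.sym G (adjacent-M (proj₂ (opposite-≢M opp)) m∈M)
    , opposite-distance opp

  between-parts : ∀ {u m v} → Between G u m v → Opposite (part u) (part v) × part m ≡ M
  between-parts {u} {m} {v} btw@((_ , ¬opp₁) , (_ , ¬opp₂) , _) =
    opp , between-opposites (part m) opp ¬opp₁ ¬opp₂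
    where
    opp : Opposite (part u) (part v)
    opp with opposite? (part u) (part v)
    ... | yes opp = opp
    ... | no ¬opp = ⊥-elim (between-nonadjacent G btw (proj₂ (proj₂ (between-distinct G btw)) , ¬opp))

  allBut : Part → Subset n
  allBut c = map (λ d → isNo (d ≟ c)) parts

  ∈allBut⁺ : ∀ {c i} → part i ≢ c → i ∈ₛ allBut c
  ∈allBut⁺ {c} {i} i∉c = lookup⇒[]= i (allBut c) (trans (lookup-map i _ parts) (isNo-≢ i∉c))
    where
    isNo-≢ : ∀ {d} → d ≢ c → isNo (d ≟ c) ≡ inside
    isNo-≢ {d} d≢c with d ≟ c
    ... | yes d≡c = contradiction d≡c d≢c
    ... | no _    = refl

  ∈allBut⁻ : ∀ {c i} → i ∈ₛ allBut c → part i ≢ c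
  ∈allBut⁻ {c} {i} i∈ i∈c = isNo-≡ i∈c (trans (sym (lookup-map i _ parts)) ([]=⇒lookup i∈))
    where
    isNo-≡ : ∀ {d} → d ≡ c → isNo (d ≟ c) ≢ inside
    isNo-≡ {d} d≡c with d ≟ c
    ... | yes _   = λ ()
    ... | no d≢c  = contradiction d≡c d≢c

  Meets : Subset n → Part → Set
  Meets S c = ∃ λ i → i ∈ₛ S × part i ≡ c

  meets? : ∀ S c → Dec (Meets S c)
  meets? S c = any? λ i → (i ∈? S) ×-dec (part i ≟ c)

  ¬meets⇒⊆allBut : ∀ {S c} → ¬ Meets S c → S ⊆ₛ allBut c
  ¬meets⇒⊆allBut ¬meets {i} i∈S = ∈allBut⁺ λ i∈c → ¬meets (i , i∈S , i∈c)

  gp⇒⊆allBut : ∀ {S} → IsGeneralPosition G S → ∃ λ c → S ⊆ₛ allBut c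
  gp⇒⊆allBut {S} gp with meets? S X | meets? S M | meets? S Y
  ... | no ¬x | _     | _     = X , ¬meets⇒⊆allBut ¬x
  ... | yes _ | no ¬m | _     = M , ¬meets⇒⊆allBut ¬m
  ... | yes _ | yes _ | no ¬y = Y , ¬meets⇒⊆allBut ¬y
  ... | yes (x , x∈S , x∈X) | yes (m , m∈S , m∈M) | yes (y , y∈S , y∈Y) =
    ⊥-elim (gp⇒¬between G gp (opposite-between (subst₂ Opposite (sym x∈X) (sym y∈Y) X-Y) m∈M) x∈S m∈S y∈S)

  module _ {hub : Fin n} (hub∈M : part hub ≡ M) where

    diameter≤2 : DiameterAtMost2 G
    diameter≤2 u v with u ≟ᶠ v | opposite? (part u) (part v)
    ... | yes refl | _       = [] , z≤n
    ... | no u≢v   | no ¬opp = ((u≢v , ¬opp) ∷ []) , s≤s z≤n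
    ... | no _     | yes opp =
      let u∉M , v∉M = opposite-≢M opp in
      (adjacent-M u∉M hub∈M ∷ Graph.sym G (adjacent-M v∉M hub∈M) ∷ []) , ≤-refl

    connected : Connected G
    connected u v = proj₁ (diameter≤2 u v)

    ⊆allBut⇒gp : ∀ {S c} → S ⊆ₛ allBut c → IsGeneralPosition G S
    ⊆allBut⇒gp {S} {c} S⊆ = ¬between⇒gp G diameter≤2 λ {u} {m} {v} btw u∈S m∈S v∈S →
      let opp , m∈M = between-parts btw in
      case opposites-cover c opp of λ where
        (inj₁ c≡u)        → ∈allBut⁻ (S⊆ u∈S) (sym c≡u)
        (inj₂ (inj₁ c≡M)) → ∈allBut⁻ (S⊆ m∈S) (trans m∈M (sym c≡M))
        (inj₂ (inj₂ c≡v)) → ∈allBut⁻ (S⊆ v∈S) (sym c≡v)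

    allBut-gp : ∀ c → IsGeneralPosition G (allBut c)
    allBut-gp c = ⊆allBut⇒gp id

    allBut-maximal : ∀ {c} → (∀ d → d ≢ c → ∃ λ i → part i ≡ d) → IsMaximalGP G (allBut c)
    allBut-maximal {c} inhabited = allBut-gp c , λ T gpT allBut⊆T {i} i∈T → ∈allBut⁺ λ i∈c →
      let d , T⊆d = gp⇒⊆allBut gpT in
      case d ≟ c of λ where
        (yes refl) → ∈allBut⁻ (T⊆d i∈T) i∈c
        (no d≢c)   → let j , j∈d = inhabited d d≢c in
          ∈allBut⁻ (T⊆d (allBut⊆T (∈allBut⁺ (λ j∈c → d≢c (trans (sym j∈d) j∈c))))) j∈d

    gp-allBut : ∀ {c₀} → (∀ c → ∣ allBut c ∣ ≤ ∣ allBut c₀ ∣) → GpNumber G ∣ allBut c₀ ∣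
    gp-allBut {c₀} largest = (allBut c₀ , allBut-gp c₀ , refl) , λ S gp →
      let c , S⊆ = gp⇒⊆allBut gp in ≤-trans (p⊆q⇒∣p∣≤∣q∣ S⊆) (largest c)

    gp⁻-allBut : ∀ {c₀} → (∀ d → d ≢ c₀ → ∃ λ i → part i ≡ d) →
      (∀ c → ∣ allBut c₀ ∣ ≤ ∣ allBut c ∣) → GpMinusNumber G ∣ allBut c₀ ∣
    gp⁻-allBut {c₀} inhabited smallest = (allBut c₀ , allBut-maximal inhabited , refl) , λ S (gp , maximal) →
      let c , S⊆ = gp⇒⊆allBut gp in
      ≤-trans (smallest c) (p⊆q⇒∣p∣≤∣q∣ (maximal (allBut c) (allBut-gp c) S⊆))

∣++∣ : ∀ {k l} (S : Subset k) (T : Subset l) → ∣ S ++ T ∣ ≡ ∣ S ∣ + ∣ T ∣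
∣++∣ []            T = refl
∣++∣ (inside ∷ S)  T = cong suc (∣++∣ S T)
∣++∣ (outside ∷ S) T = ∣++∣ S T

Realisation : ℕ → ℕ → ℕ → Set₁
Realisation n a b = Σ (Graph n) λ G → Connected G × GpMinusNumber G a × GpNumber G b

module Layout (p q r : ℕ) where

  parts : Vec Part (p + (q + r))
  parts = replicate p X ++ (replicate q M ++ replicate r Y)

  open GluedCliques parts

  part-X : ∀ i → part (i ↑ˡ (q + r)) ≡ X
  part-X i = trans (lookup-++ˡ (replicate p X) _ i) (lookup-replicate i X)

  part-M : ∀ j → part (p ↑ʳ (j ↑ˡ r)) ≡ M
  part-M j = begin
    part (p ↑ʳ (j ↑ˡ r))                              ≡⟨ lookup-++ʳ (replicate p X) _ (j ↑ˡ r) ⟩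
    lookup (replicate q M ++ replicate r Y) (j ↑ˡ r)  ≡⟨ lookup-++ˡ (replicate q M) _ j ⟩
    lookup (replicate q M) j                          ≡⟨ lookup-replicate j M ⟩
    M                                                 ∎
    where open ≡-Reasoning

  ∣map-parts∣ : (f : Part → Side) →
    ∣ map f parts ∣ ≡ ∣ replicate p (f X) ∣ + (∣ replicate q (f M) ∣ + ∣ replicate r (f Y) ∣)
  ∣map-parts∣ f = begin
    ∣ map f parts ∣
      ≡⟨ cong ∣_∣ (trans (map-++ f (replicate p X) _) (cong (map f (replicate p X) ++_) (map-++ f (replicate q M) _))) ⟩
    ∣ map f (replicate p X) ++ (map f (replicate q M) ++ map f (replicate r Y)) ∣
      ≡⟨ cong ∣_∣ (cong₂ _++_ (map-replicate f X p) (cong₂ _++_ (map-replicate f M q) (map-replicate f Y r))) ⟩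
    ∣ replicate p (f X) ++ (replicate q (f M) ++ replicate r (f Y)) ∣
      ≡⟨ trans (∣++∣ (replicate p (f X)) _) (cong (∣ replicate p (f X) ∣ +_) (∣++∣ (replicate q (f M)) _)) ⟩
    ∣ replicate p (f X) ∣ + (∣ replicate q (f M) ∣ + ∣ replicate r (f Y) ∣) ∎
    where open ≡-Reasoning

  ∣allBut-X∣ : ∣ allBut X ∣ ≡ q + r
  ∣allBut-X∣ = trans (∣map-parts∣ _) (cong₂ _+_ (∣⊥∣≡0 p) (cong₂ _+_ (∣⊤∣≡n q) (∣⊤∣≡n r)))

  ∣allBut-M∣ : ∣ allBut M ∣ ≡ p + r
  ∣allBut-M∣ = trans (∣map-parts∣ _) (cong₂ _+_ (∣⊤∣≡n p) (cong₂ _+_ (∣⊥∣≡0 q) (∣⊤∣≡n r)))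

  ∣allBut-Y∣ : ∣ allBut Y ∣ ≡ p + q
  ∣allBut-Y∣ = trans (∣map-parts∣ _) (cong₂ _+_ (∣⊤∣≡n p) (trans (cong₂ _+_ (∣⊤∣≡n q) (∣⊥∣≡0 r)) (+-identityʳ q)))

  realisation : 1 ≤ p → p ≤ q → q ≤ r → Realisation (p + (q + r)) (p + q) (q + r)
  realisation 1≤p p≤q q≤r =
      G
    , connected hub∈M
    , subst (GpMinusNumber G) ∣allBut-Y∣ (gp⁻-allBut hub∈M inhabited smallest)
    , subst (GpNumber G) ∣allBut-X∣ (gp-allBut hub∈M largest)
    where
    hub∈M : part (p ↑ʳ (fromℕ< (≤-trans 1≤p p≤q) ↑ˡ r)) ≡ M
    hub∈M = part-M _
    inhabited : ∀ d → d ≢ Y → ∃ λ i → part i ≡ d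
    inhabited X _ = _ , part-X (fromℕ< 1≤p)
    inhabited M _ = _ , hub∈M
    inhabited Y Y≢Y = contradiction refl Y≢Y
    largest : ∀ c → ∣ allBut c ∣ ≤ ∣ allBut X ∣
    largest X = ≤-refl
    largest M rewrite ∣allBut-M∣ | ∣allBut-X∣ = +-monoˡ-≤ r p≤q
    largest Y rewrite ∣allBut-Y∣ | ∣allBut-X∣ = +-mono-≤ p≤q q≤r
    smallest : ∀ c → ∣ allBut Y ∣ ≤ ∣ allBut c ∣
    smallest X rewrite ∣allBut-Y∣ | ∣allBut-X∣ = +-mono-≤ p≤q q≤r
    smallest M rewrite ∣allBut-Y∣ | ∣allBut-M∣ = +-monoʳ-≤ p q≤r
    smallest Y = ≤-refl

half-bounds : ∀ m → m / 2 + m / 2 ≤ m × m ≤ suc (m / 2 + m / 2)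
half-bounds m =
    subst₂ _≤_ h*2≡h+h (sym m≡) (m≤n+m (h * 2) (m % 2))
  , subst₂ _≤_ (sym m≡) (cong suc h*2≡h+h) (+-monoˡ-≤ (h * 2) (≤-pred (m%n<n m 2)))
  where
  h : ℕ
  h = m / 2
  h*2≡h+h : h * 2 ≡ h + h
  h*2≡h+h = trans (*-comm h 2) (cong (h +_) (+-identityʳ h))
  m≡ : m ≡ m % 2 + h * 2
  m≡ = m≡m%n+[m/n]*n m 2

record PartSizes (a b : ℕ) : Set where
  field
    p q r : ℕ
    1≤p   : 1 ≤ p
    p≤q   : p ≤ q
    q≤r   : q ≤ r
    p+q≡a : p + q ≡ a
    q+r≡b : q + r ≡ b
    p≡    : p ≡ 1 ⊔ (a ∸ b / 2)

-- q = min(a − 1, ⌊b/2⌋), so that p = a − q = max(1, a − ⌊b/2⌋)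
partSizes : ∀ {a b} → 2 ≤ a → a < b → PartSizes a b
partSizes {suc a′} {b} (s≤s 1≤a′) a<b = record
  { p = suc a′ ∸ q ; q = q ; r = b ∸ q
  ; 1≤p   = m<n⇒0<n∸m q<a
  ; p≤q   = m≤n+o⇒m∸n≤o (suc a′) q a≤q+q
  ; q≤r   = m+n≤o⇒m≤o∸n q q+q≤b
  ; p+q≡a = m∸n+n≡m (<⇒≤ q<a)
  ; q+r≡b = m+[n∸m]≡n (≤-trans (m≤m+n q q) q+q≤b)
  ; p≡    = trans (∸-distribˡ-⊓-⊔ (suc a′) a′ h) (cong (_⊔ (suc a′ ∸ h)) (m+n∸n≡m 1 a′))
  }
  where
  h q : ℕ
  h = b / 2
  q = a′ ⊓ h
  q<a : q < suc a′
  q<a = s≤s (m⊓n≤m a′ h)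
  q+q≤b : q + q ≤ b
  q+q≤b = ≤-trans (+-mono-≤ (m⊓n≤n a′ h) (m⊓n≤n a′ h)) (proj₁ (half-bounds b))
  a≤q+q : suc a′ ≤ q + q
  a≤q+q with ⊓-sel a′ h
  ... | inj₁ q≡a′ rewrite q≡a′ = subst (_≤ a′ + a′) (+-comm a′ 1) (+-monoʳ-≤ a′ 1≤a′)
  ... | inj₂ q≡h  rewrite q≡h  = ≤-pred (≤-trans a<b (proj₂ (half-bounds b)))

theorem3p4 : (a b : ℕ) → 2 ≤ a → a < b →
    Σ (Graph (b + (1 ⊔ (a ∸ b / 2)))) λ G →
      Connected G × GpMinusNumber G a × GpNumber G b
theorem3p4 a b 2≤a a<b =
  subst (λ n → Realisation n a b) n≡
    (subst₂ (Realisation (p + (q + r))) p+q≡a q+r≡b (Layout.realisation p q r 1≤p p≤q q≤r))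
  where
  open PartSizes (partSizes 2≤a a<b)
  n≡ : p + (q + r) ≡ b + (1 ⊔ (a ∸ b / 2))
  n≡ = trans (cong (p +_) q+r≡b) (trans (+-comm p b) (cong (b +_) p≡))
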